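{- Let $n, m \geq 1$ and $1 \leq a \leq n-1$, and let $x_j^{(c)} \in \mathbb{R}$ be given for $1 \leq j \leq m$ and $c \in \mathbb{Z}/n\mathbb{Z}$. Let $v = (-a, n-a) \in \mathbb{Z}^2$. Let $U \subseteq \mathbb{Z}^2$ be a set of cells with $U + v = U$, let $\theta = U / \mathbb{Z}v$ be the corresponding cylindric shape, and for an integer $t \geq 1$ let $\xi = U / \mathbb{Z}(tv)$ be the cylindric shape consisting of $t$ repetitions of $\theta$ (so $\theta$ and $\xi$ have the same universal cover $U$). Let $\mathcal{T}'$ be a cylindric semistandard tableau of shape $\xi$. Then \[ \operatorname{wt}(\mathcal{T}') \geq t \cdot \min_{\mathcal{T}} \operatorname{wt}(\mathcal{T}), \] where the minimum is taken over all cylindric semistandard tableaux $\mathcal{T}$ of shape $\theta$.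
   Context: Cells of $\mathbb{Z}^2$ are indexed $(i,j)$ with $i$ the row (increasing downward) and $j$ the column (increasing to the right); the content of a cell $\mathfrak{s} = (i,j)$ is $c(\mathfrak{s}) = i - j$. For $w \in \{v, tv\}$, a cylindric semistandard tableau of shape $U/\mathbb{Z}w$ (with entries at most $m$) is a map $F \colon U \to \{1, \dotsc, m\}$ with $F(\mathfrak{s} + w) = F(\mathfrak{s})$ for all $\mathfrak{s} \in U$, such that $F(i,j) \leq F(i,j+1)$ whenever both cells lie in $U$, and $F(i,j) < F(i+1,j)$ whenever both cells lie in $U$. Since translation by $v$ changes content by $-n$, the quantity $x_{F(\mathfrak{s})}^{(c(\mathfrak{s}) \bmod n)}$ is invariant under translating $\mathfrak{s}$ by $v$. The weight of such a tableau is $\operatorname{wt}(F) = \sum_{\mathfrak{s} \in D} x_{F(\mathfrak{s})}^{(c(\mathfrak{s}) \bmod n)}$, where $D$ is a set of representatives of $U/\mathbb{Z}w$ (a fundamental domain); this is the tropicalization of the monomial attached to the tableau in a (cylindric) loop Schur function. -}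

module Defs where

open import Level using (Level; _⊔_) renaming (suc to lsuc)
open import Algebra.Bundles using (AbelianGroup)
open import Relation.Binary.Core using (Rel)
open import Relation.Binary.Structures using (IsTotalOrder)
open import Data.Nat as ℕ using (ℕ; NonZero)
open import Data.Integer as ℤ using (ℤ; +_; -_; _-_)
open import Data.Integer.DivMod using (_%ℕ_; n%ℕd<d)
open import Data.Fin using (Fin; fromℕ<; toℕ)
open import Data.Product using (_×_; _,_; Σ; ∃)
open import Data.List using (List; length; lookup; foldr; map)
open import Relation.Binary.PropositionalEquality using (_≡_)

-- Values: a linearly ordered abelian group (ℝ with + and ≤ is one).

record LinOrdAbGroup (c ℓ₁ ℓ₂ : Level) : Set (lsuc (c ⊔ ℓ₁ ⊔ ℓ₂)) where
  field
    abelianGroup : AbelianGroup c ℓ₁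
  open AbelianGroup abelianGroup public
  field
    _≤_          : Rel Carrier ℓ₂
    isTotalOrder : IsTotalOrder _≈_ _≤_
    ∙-monoˡ-≤    : ∀ z {x y} → x ≤ y → (x ∙ z) ≤ (y ∙ z)

  Σ-list : List Carrier → Carrier
  Σ-list = foldr _∙_ ε

  _·_ : ℕ → Carrier → Carrier
  ℕ.zero  · x = ε
  ℕ.suc t · x = x ∙ (t · x)

-- Cells of ℤ², (row , column)

Cell : Set
Cell = ℤ × ℤ

_⊕_ : Cell → Cell → Cell
(i , j) ⊕ (k , l) = (i ℤ.+ k , j ℤ.+ l)

_⊛_ : ℤ → Cell → Cell
k ⊛ (i , j) = (k ℤ.* i , k ℤ.* j)

vec : ℕ → ℕ → Cell
vec n a = (- (+ a) , + n - + a)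

-- content c(s) = i - j, reduced mod n, as an element of ℤ/nℤ ≅ Fin n
content : Cell → ℤ
content (i , j) = i - j

colour : (n : ℕ) .{{_ : NonZero n}} → Cell → Fin n
colour n s = fromℕ< (n%ℕd<d (content s) n)

Invariant : (Cell → Set) → Cell → Set
Invariant U w = ∀ s → (U s → U (s ⊕ w)) × (U (s ⊕ w) → U s)

-- D is a (finite) set of representatives of U / ℤw:
-- every element of D lies in U, every cell of U is a ℤw-translate of
-- some element of D, and distinct positions of D lie in distinct orbits.
IsFundamentalDomain : (Cell → Set) → Cell → List Cell → Set
IsFundamentalDomain U w D =
  (∀ (p : Fin (length D)) → U (lookup D p)) ×
  (∀ s → U s → Σ (Fin (length D)) λ p → ∃ λ (k : ℤ) → s ≡ lookup D p ⊕ (k ⊛ w)) ×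
  (∀ (p q : Fin (length D)) (k : ℤ) → lookup D p ≡ lookup D q ⊕ (k ⊛ w) → p ≡ q)

-- Cylindric semistandard tableaux of shape U / ℤw with entries in
-- {1,…,m}, encoded as Fin m (entry r+1 ↔ r : Fin m).  F is a function on
-- all of ℤ²; only its values on U matter.

right down : Cell → Cell
right (i , j) = (i , j ℤ.+ + 1)
down  (i , j) = (i ℤ.+ + 1 , j)

record IsCSST (m : ℕ) (U : Cell → Set) (w : Cell) (F : Cell → Fin m) : Set where
  field
    periodic : ∀ s → U s → F (s ⊕ w) ≡ F s
    rows     : ∀ s → U s → U (right s) → toℕ (F s) ℕ.≤ toℕ (F (right s))
    columns  : ∀ s → U s → U (down s) → toℕ (F s) ℕ.< toℕ (F (down s))

module _ {c ℓ₁ ℓ₂} (G : LinOrdAbGroup c ℓ₁ ℓ₂) where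
  open LinOrdAbGroup G

  wt : (n m : ℕ) .{{_ : NonZero n}} → (Fin m → Fin n → Carrier) →
       List Cell → (Cell → Fin m) → Carrier
  wt n m x D F = Σ-list (map (λ s → x (F s) (colour n s)) D)

-- For each cell s, sort the t values F′(s), F′(s + v), …, F′(s + (t − 1)v) of the tableau F′
-- of period tv; the k-th smallest of them, as a function of s, is a tableau T_k of period v.
-- It is v-periodic because sorting ignores the cyclic shift s ↦ s + v of this list, and it is
-- semistandard because sorting is monotone for pointwise ≤ and <.  At each cell d of a
-- fundamental domain D of U/ℤv the values T_k(d) are a permutation of the F′(d + jv), colours
-- are v-invariant, and the cells d + jv (d ∈ D, 0 ≤ j < t) form a fundamental domain of U/ℤtv;
-- hence Σ_k wt(T_k) = wt(F′) ≥ t · min wt.  The minimum is attained because a tableau of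
-- period v is determined by its values on the finite set D, and whether given values on D
-- extend to a tableau is decidable.

module Submission where

open import Defs
open import Data.Nat using (ℕ; NonZero; _∸_)
open import Data.Nat as ℕ using ()
open import Data.Integer using (+_)
open import Data.Fin using (Fin)
open import Data.List using (List)
open import Data.Product using (Σ; _×_)

open import Level using (0ℓ)
open import Function.Base using (_∘_)
open import Data.Nat using (zero; suc)
import Data.Nat.Properties as ℕ
open import Data.Integer as ℤ using (ℤ; -[1+_]; -_; _-_)
import Data.Integer.Properties as ℤP
open import Data.Integer.DivMod using (_/ℕ_; _%ℕ_; n%ℕd<d; a≡a%ℕn+[a/ℕn]*n; [n/ℕd]*d≤n; n<s[n/ℕd]*d)
open import Data.Integer.Tactic.RingSolver using (solve-∀)
open import Data.Fin as Fin using (toℕ; fromℕ<; combine; remQuot; _↑ˡ_; _↑ʳ_; finToFun; funToFin)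
import Data.Fin.Properties as Fin
open import Data.Fin.Properties using (any?; all?)
open import Data.Fin.Permutation using (Permutation; permutation)
open import Data.Vec as Vec using (Vec; []; _∷_; _∷ʳ_)
open import Data.Vec.Relation.Binary.Pointwise.Inductive as Pointwise using (Pointwise; []; _∷_)
open import Data.List as List using (List; length; map)
open import Data.Product using (_,_; proj₁; proj₂; uncurry)
import Data.Product.Properties as Product
open import Data.Sum as ⊎ using (_⊎_; inj₁; inj₂)
open import Data.Empty using (⊥-elim)
open import Relation.Nullary using (¬_; Dec; yes; no)
open import Relation.Nullary.Decidable using (_×-dec_; _→-dec_)
open import Relation.Unary using (Pred; Decidable)
open import Relation.Binary using (Rel; Trans; IsTotalOrder; IsTotalPreorder; TotalOrder)
open import Relation.Binary.PropositionalEquality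
  using (_≡_; refl; sym; trans; cong; cong₂; subst; subst₂; _≗_; module ≡-Reasoning)
open import Algebra.Bundles using (CommutativeMonoid)
import Algebra.Properties.CommutativeMonoid.Sum as Sum
import Algebra.Properties.CommutativeSemigroup as CommutativeSemigroup

-- Integer division with remainder

module _ where
  open import Data.Integer using (_+_; _*_; _≤_; _<_) renaming (suc to sucℤ)
  open import Algebra.Properties.AbelianGroup ℤP.+-0-abelianGroup using (∙-cancelʳ)

  quotient-≤ : ∀ {q q′ z} d → q * + d ≤ z → z < sucℤ q′ * + d → q ≤ q′
  quotient-≤ d qd≤z z<[q′+1]d = ℤP.≮⇒≥ λ q′<q →
    ℤP.<⇒≱ z<[q′+1]d (ℤP.≤-trans (ℤP.*-monoʳ-≤-nonNeg (+ d) (ℤP.i<j⇒suc[i]≤j q′<q)) qd≤z)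

  module _ (z : ℤ) (d : ℕ) .{{_ : NonZero d}} {r : ℕ} {q : ℤ}
           (r<d : r ℕ.< d) (z≡r+qd : z ≡ + r + q * + d) where

    /ℕ-unique : z /ℕ d ≡ q
    /ℕ-unique = ℤP.≤-antisym (quotient-≤ d ([n/ℕd]*d≤n z d) z<[q+1]d)
                            (quotient-≤ d qd≤z (n<s[n/ℕd]*d z d))
      where
      qd≤z : q * + d ≤ z
      qd≤z = subst (q * + d ≤_) (sym z≡r+qd) (ℤP.i≤j+i (q * + d) (+ r))
      [q+1]d : ∀ q d → d + q * d ≡ (+ 1 + q) * d
      [q+1]d = solve-∀
      z<[q+1]d : z < sucℤ q * + d
      z<[q+1]d = subst₂ _<_ (sym z≡r+qd) ([q+1]d q (+ d)) (ℤP.+-monoˡ-< (q * + d) (ℤ.+<+ r<d))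

    %ℕ-unique : z %ℕ d ≡ r
    %ℕ-unique = ℤP.+-injective (∙-cancelʳ (q * + d) _ _ (begin
      + (z %ℕ d) + q * + d       ≡⟨ cong (λ k → + (z %ℕ d) + k * + d) /ℕ-unique ⟨
      + (z %ℕ d) + z /ℕ d * + d  ≡⟨ a≡a%ℕn+[a/ℕn]*n z d ⟨
      z                          ≡⟨ z≡r+qd ⟩
      + r + q * + d              ∎))
      where open ≡-Reasoning

  %ℕ-periodic : ∀ z k d .{{_ : NonZero d}} → (z + k * + d) %ℕ d ≡ z %ℕ d
  %ℕ-periodic z k d = %ℕ-unique (z + k * + d) d {q = z /ℕ d + k} (n%ℕd<d z d)
    (trans (cong (_+ k * + d) (a≡a%ℕn+[a/ℕn]*n z d)) (regroup (+ (z %ℕ d)) (z /ℕ d) k (+ d)))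
    where
    regroup : ∀ r q k d → (r + q * d) + k * d ≡ r + (q + k) * d
    regroup = solve-∀

  [k*d]/ℕd≡k : ∀ k d .{{_ : NonZero d}} → (k * + d) /ℕ d ≡ k
  [k*d]/ℕd≡k k d = /ℕ-unique (k * + d) d {q = k} (ℕ.>-nonZero⁻¹ d) (sym (ℤP.+-identityˡ (k * + d)))

  [r]%ℕd≡r : ∀ {r} d .{{_ : NonZero d}} → r ℕ.< d → (+ r) %ℕ d ≡ r
  [r]%ℕd≡r {r} d r<d = %ℕ-unique (+ r) d {q = + 0} r<d (sym (ℤP.+-identityʳ (+ r)))

module _ where
  open import Data.Integer using (_+_; _*_) renaming (suc to sucℤ)

  ⊕-0⊛ : ∀ s w → s ⊕ ((+ 0) ⊛ w) ≡ s
  ⊕-0⊛ (i , j) (p , q) = cong₂ _,_ (ring i p) (ring j q)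
    where
    ring : ∀ i p → i + + 0 * p ≡ i
    ring = solve-∀

  ⊕-suc⊛ : ∀ s w k → s ⊕ (sucℤ k ⊛ w) ≡ (s ⊕ w) ⊕ (k ⊛ w)
  ⊕-suc⊛ (i , j) (p , q) k = cong₂ _,_ (ring i p k) (ring j q k)
    where
    ring : ∀ i p k → i + (+ 1 + k) * p ≡ (i + p) + k * p
    ring = solve-∀

  ⊕-⊛-+ : ∀ s w k l → (s ⊕ (k ⊛ w)) ⊕ (l ⊛ w) ≡ s ⊕ ((k + l) ⊛ w)
  ⊕-⊛-+ (i , j) (p , q) k l = cong₂ _,_ (ring i p k l) (ring j q k l)
    where
    ring : ∀ i p k l → (i + k * p) + l * p ≡ i + (k + l) * p
    ring = solve-∀

  ⊕-⊛-cancel : ∀ s w k → (s ⊕ (k ⊛ w)) ⊕ ((- k) ⊛ w) ≡ s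
  ⊕-⊛-cancel (i , j) (p , q) k = cong₂ _,_ (ring i p k) (ring j q k)
    where
    ring : ∀ i p k → (i + k * p) + (- k) * p ≡ i
    ring = solve-∀

  ⊛-assoc : ∀ k l w → k ⊛ (l ⊛ w) ≡ (k * l) ⊛ w
  ⊛-assoc k l (p , q) = cong₂ _,_ (ring k l p) (ring k l q)
    where
    ring : ∀ k l p → k * (l * p) ≡ (k * l) * p
    ring = solve-∀

  ⊕-⊛-split : ∀ s w k l t → s ⊕ ((k + l * t) ⊛ w) ≡ (s ⊕ (k ⊛ w)) ⊕ (l ⊛ (t ⊛ w))
  ⊕-⊛-split (i , j) (p , q) k l t = cong₂ _,_ (ring i p k l t) (ring j q k l t)
    where
    ring : ∀ i p k l t → i + (k + l * t) * p ≡ (i + k * p) + l * (t * p)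
    ring = solve-∀

  right-⊕ : ∀ s d → right (s ⊕ d) ≡ right s ⊕ d
  right-⊕ (i , j) (p , q) = cong (i + p ,_) (ring j q)
    where
    ring : ∀ j q → (j + q) + + 1 ≡ (j + + 1) + q
    ring = solve-∀

  down-⊕ : ∀ s d → down (s ⊕ d) ≡ down s ⊕ d
  down-⊕ (i , j) (p , q) = cong (_, j + q) (ring i p)
    where
    ring : ∀ i p → (i + p) + + 1 ≡ (i + + 1) + p
    ring = solve-∀

record InOrbit (w s d : Cell) : Set where
  constructor ⟨_,_⟩
  field
    steps : ℤ
    translates : s ≡ d ⊕ (steps ⊛ w)

module _ {w : Cell} where

  inOrbit-refl : ∀ s → InOrbit w s s
  inOrbit-refl s = ⟨ + 0 , sym (⊕-0⊛ s w) ⟩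

  inOrbit-sym : ∀ {s d} → InOrbit w s d → InOrbit w d s
  inOrbit-sym {d = d} ⟨ k , refl ⟩ = ⟨ - k , sym (⊕-⊛-cancel d w k) ⟩

  inOrbit-trans : ∀ {s d e} → InOrbit w s d → InOrbit w d e → InOrbit w s e
  inOrbit-trans {e = e} ⟨ k , refl ⟩ ⟨ l , refl ⟩ = ⟨ l ℤ.+ k , ⊕-⊛-+ e w l k ⟩

  inOrbit-⊕ : ∀ s k → InOrbit w (s ⊕ (k ⊛ w)) s
  inOrbit-⊕ s k = ⟨ k , refl ⟩

  inOrbit-step : ∀ s → InOrbit w (s ⊕ w) s
  inOrbit-step s = ⟨ + 1 , sym (trans (⊕-suc⊛ s w (+ 0)) (⊕-0⊛ (s ⊕ w) w)) ⟩

  inOrbit-⊛ : ∀ {k s d} → InOrbit (k ⊛ w) s d → InOrbit w s d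
  inOrbit-⊛ {k} {d = d} ⟨ l , refl ⟩ = ⟨ l ℤ.* k , cong (d ⊕_) (⊛-assoc l k w) ⟩

  inOrbit-map : (φ : Cell → Cell) → (∀ s d → φ (s ⊕ d) ≡ φ s ⊕ d) →
                ∀ {s d} → InOrbit w s d → InOrbit w (φ s) (φ d)
  inOrbit-map φ φ-⊕ {d = d} ⟨ k , refl ⟩ = ⟨ k , φ-⊕ d (k ⊛ w) ⟩

module _ {U : Cell → Set} {w : Cell} (inv : Invariant U w) where

  invariant-+⊛ : ∀ n d → (U d → U (d ⊕ ((+ n) ⊛ w))) × (U (d ⊕ ((+ n) ⊛ w)) → U d)
  invariant-+⊛ zero d = subst U (sym (⊕-0⊛ d w)) , subst U (⊕-0⊛ d w)
  invariant-+⊛ (suc n) d =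
    let (to , from) = invariant-+⊛ n (d ⊕ w) in
    subst U (sym (⊕-suc⊛ d w (+ n))) ∘ to ∘ proj₁ (inv d) ,
    proj₂ (inv d) ∘ from ∘ subst U (⊕-suc⊛ d w (+ n))

  invariant-⊛ : ∀ k d → U d → U (d ⊕ (k ⊛ w))
  invariant-⊛ (+ n)      d = proj₁ (invariant-+⊛ n d)
  invariant-⊛ k@(-[1+ n ]) d u =
    proj₂ (invariant-+⊛ (suc n) (d ⊕ (k ⊛ w))) (subst U (sym (⊕-⊛-cancel d w k)) u)

  invariant-inOrbit : ∀ {s d} → InOrbit w s d → U d → U s
  invariant-inOrbit ⟨ k , refl ⟩ = invariant-⊛ k _

  invariant-multiple : ∀ k → Invariant U (k ⊛ w)
  invariant-multiple k s = invariant-⊛ k s , invariant-inOrbit (inOrbit-sym ⟨ k , refl ⟩)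

  module _ {a} {A : Set a} (f : Cell → A) (periodic : ∀ s → U s → f (s ⊕ w) ≡ f s) where

    periodic-+⊛ : ∀ n d → U d → f (d ⊕ ((+ n) ⊛ w)) ≡ f d
    periodic-+⊛ zero    d _ = cong f (⊕-0⊛ d w)
    periodic-+⊛ (suc n) d u = begin
      f (d ⊕ ((+ suc n) ⊛ w))        ≡⟨ cong f (⊕-suc⊛ d w (+ n)) ⟩
      f ((d ⊕ w) ⊕ ((+ n) ⊛ w))      ≡⟨ periodic-+⊛ n (d ⊕ w) (proj₁ (inv d) u) ⟩
      f (d ⊕ w)                      ≡⟨ periodic d u ⟩
      f d                            ∎
      where open ≡-Reasoning

    periodic-inOrbit : ∀ {s d} → InOrbit w s d → U d → f s ≡ f d
    periodic-inOrbit {d = d} ⟨ + n , refl ⟩ u = periodic-+⊛ n d u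
    periodic-inOrbit {d = d} ⟨ k@(-[1+ n ]) , refl ⟩ u = sym (begin
      f d                                          ≡⟨ cong f (⊕-⊛-cancel d w k) ⟨
      f ((d ⊕ (k ⊛ w)) ⊕ ((+ suc n) ⊛ w))          ≡⟨ periodic-+⊛ (suc n) _ (invariant-⊛ k d u) ⟩
      f (d ⊕ (k ⊛ w))                              ∎)
      where open ≡-Reasoning

-- Transversals of U / ℤw

record IsTransversal (U : Cell → Set) (w : Cell) {N : ℕ} (e : Fin N → Cell) : Set where
  field
    ⊆U        : ∀ p → U (e p)
    covers    : ∀ s → U s → Σ (Fin N) λ p → InOrbit w s (e p)
    separates : ∀ p q → InOrbit w (e p) (e q) → p ≡ q

fundamentalDomain⇒transversal : ∀ {U w} D → IsFundamentalDomain U w D → IsTransversal U w (List.lookup D)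
fundamentalDomain⇒transversal D (⊆U , covers , separates) = record
  { ⊆U        = ⊆U
  ; covers    = λ s u → let (p , k , eq) = covers s u in p , ⟨ k , eq ⟩
  ; separates = λ { p q ⟨ k , eq ⟩ → separates p q k eq }
  }

module _ {U : Cell → Set} {w : Cell} where
  open IsTransversal

  reindex : ∀ {N N′} {e : Fin N → Cell} {e′ : Fin N′ → Cell} →
            IsTransversal U w e → IsTransversal U w e′ → Fin N → Fin N′
  reindex {e = e} τ τ′ p = proj₁ (covers τ′ (e p) (⊆U τ p))

  reindex-inOrbit : ∀ {N N′} {e : Fin N → Cell} {e′ : Fin N′ → Cell}
                    (τ : IsTransversal U w e) (τ′ : IsTransversal U w e′) p →
                    InOrbit w (e p) (e′ (reindex τ τ′ p))
  reindex-inOrbit {e = e} τ τ′ p = proj₂ (covers τ′ (e p) (⊆U τ p))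

  reindex-inverse : ∀ {N N′} {e : Fin N → Cell} {e′ : Fin N′ → Cell}
                    (τ : IsTransversal U w e) (τ′ : IsTransversal U w e′) p →
                    reindex τ′ τ (reindex τ τ′ p) ≡ p
  reindex-inverse τ τ′ p = sym (separates τ _ _
    (inOrbit-trans (reindex-inOrbit τ τ′ p) (reindex-inOrbit τ′ τ (reindex τ τ′ p))))

  module _ (inv : Invariant U w) {c ℓ} (M : CommutativeMonoid c ℓ) where
    open CommutativeMonoid M using (Carrier; _≈_)
    open Sum M using (sum; ∑-permute)

    transversal-sum : (g : Cell → Carrier) → (∀ s → U s → g (s ⊕ w) ≡ g s) →
                      ∀ {N N′} {e : Fin N → Cell} {e′ : Fin N′ → Cell} →
                      IsTransversal U w e → IsTransversal U w e′ → sum (g ∘ e) ≈ sum (g ∘ e′)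
    transversal-sum g periodic {e = e} {e′} τ τ′ = begin
      sum (g ∘ e)                                  ≈⟨ ∑-permute (g ∘ e) π ⟩
      sum (λ q → g (e (reindex τ′ τ q)))           ≡⟨ sum-cong-≗ same-orbit ⟨
      sum (g ∘ e′)                                 ∎
      where
      open import Relation.Binary.Reasoning.Setoid (CommutativeMonoid.setoid M)
      open Sum M using (sum-cong-≗)
      π : Permutation _ _
      π = permutation (reindex τ′ τ) (reindex τ τ′) (reindex-inverse τ τ′) (reindex-inverse τ′ τ)
      same-orbit : ∀ q → g (e′ q) ≡ g (e (reindex τ′ τ q))
      same-orbit q = periodic-inOrbit inv g periodic (reindex-inOrbit τ′ τ q) (⊆U τ _)

module _ (n a : ℕ) .{{_ : NonZero a}} where
  open import Data.Integer using (_+_; _*_)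

  private
    v : Cell
    v = vec n a

  -- The row of a cell changes by −a ≠ 0 under v, so the row difference determines the
  -- number of steps between two cells of an orbit.
  orbitIndex : Cell → Cell → ℤ
  orbitIndex s d = (proj₁ d - proj₁ s) /ℕ a

  orbitIndex-correct : ∀ {s} d k → s ≡ d ⊕ (k ⊛ v) → orbitIndex s d ≡ k
  orbitIndex-correct (d₁ , _) k refl =
    trans (cong (_/ℕ a) (ring d₁ k (+ a))) ([k*d]/ℕd≡k k a)
    where
    ring : ∀ d k a → d - (d + k * (- a)) ≡ k * a
    ring = solve-∀

  ⊛-injective : ∀ d {k l} → d ⊕ (k ⊛ v) ≡ d ⊕ (l ⊛ v) → k ≡ l
  ⊛-injective d {k} {l} eq = trans (sym (orbitIndex-correct d k refl)) (orbitIndex-correct d l eq)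

  inOrbit? : ∀ s d → Dec (InOrbit v s d)
  inOrbit? s d with Product.≡-dec ℤ._≟_ ℤ._≟_ s (d ⊕ (orbitIndex s d ⊛ v))
  ... | yes eq = yes ⟨ orbitIndex s d , eq ⟩
  ... | no neq = no λ { ⟨ k , eq ⟩ →
    neq (subst (λ k → s ≡ d ⊕ (k ⊛ v)) (sym (orbitIndex-correct d k eq)) eq) }

  colour-⊕-⊛ : .{{_ : NonZero n}} → ∀ s k → colour n (s ⊕ (k ⊛ v)) ≡ colour n s
  colour-⊕-⊛ (i , j) k = Fin.fromℕ<-cong _ _
    (trans (cong (_%ℕ n) (ring i j k (+ a) (+ n))) (%ℕ-periodic (i - j) (- k) n)) _ _
    where
    ring : ∀ i j k a n → (i + k * (- a)) - (j + k * (n - a)) ≡ (i - j) + (- k) * n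
    ring = solve-∀

module _ (n a : ℕ) .{{_ : NonZero a}} {U : Cell → Set} (inv : Invariant U (vec n a))
         {N : ℕ} {e : Fin N → Cell} (τ : IsTransversal U (vec n a) e) (t : ℕ) .{{_ : NonZero t}} where
  open import Data.Integer using (_+_; _*_)
  open IsTransversal τ

  private
    v : Cell
    v = vec n a

  repeated : Fin N × Fin t → Cell
  repeated (p , j) = e p ⊕ ((+ toℕ j) ⊛ v)

  repeated-covers : ∀ s → U s → Σ (Fin N × Fin t) λ pj → InOrbit ((+ t) ⊛ v) s (repeated pj)
  repeated-covers s u with covers s u
  ... | p , ⟨ k , refl ⟩ = (p , fromℕ< (n%ℕd<d k t)) , ⟨ k /ℕ t , translates ⟩
    where
    open ≡-Reasoning
    translates : e p ⊕ (k ⊛ v) ≡ repeated (p , fromℕ< (n%ℕd<d k t)) ⊕ ((k /ℕ t) ⊛ ((+ t) ⊛ v))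
    translates = begin
      e p ⊕ (k ⊛ v)
        ≡⟨ cong (λ k → e p ⊕ (k ⊛ v)) (a≡a%ℕn+[a/ℕn]*n k t) ⟩
      e p ⊕ ((+ (k %ℕ t) + k /ℕ t * + t) ⊛ v)
        ≡⟨ ⊕-⊛-split (e p) v (+ (k %ℕ t)) (k /ℕ t) (+ t) ⟩
      (e p ⊕ ((+ (k %ℕ t)) ⊛ v)) ⊕ ((k /ℕ t) ⊛ ((+ t) ⊛ v))
        ≡⟨ cong (λ r → (e p ⊕ ((+ r) ⊛ v)) ⊕ ((k /ℕ t) ⊛ ((+ t) ⊛ v))) (Fin.toℕ-fromℕ< (n%ℕd<d k t)) ⟨
      repeated (p , fromℕ< (n%ℕd<d k t)) ⊕ ((k /ℕ t) ⊛ ((+ t) ⊛ v)) ∎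

  repeated-separates : ∀ pj pj′ → InOrbit ((+ t) ⊛ v) (repeated pj) (repeated pj′) → pj ≡ pj′
  repeated-separates (p , j) (p′ , j′) o@(⟨ l , translates ⟩)
    with separates p p′ (inOrbit-trans (inOrbit-sym (inOrbit-⊕ (e p) (+ toℕ j)))
                          (inOrbit-trans (inOrbit-⊛ {k = + t} o) (inOrbit-⊕ (e p′) (+ toℕ j′))))
  ... | refl = cong (p ,_) (Fin.toℕ-injective (trans (sym ([r]%ℕd≡r t (Fin.toℕ<n j)))
                  (%ℕ-unique (+ toℕ j) t {q = l} (Fin.toℕ<n j′) (⊛-injective n a (e p) same-cell))))
    where
    same-cell : e p ⊕ ((+ toℕ j) ⊛ v) ≡ e p ⊕ ((+ toℕ j′ + l * + t) ⊛ v)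
    same-cell = trans translates (sym (⊕-⊛-split (e p) v (+ toℕ j′) l (+ t)))

  repeated-isTransversal : IsTransversal U ((+ t) ⊛ v) (repeated ∘ remQuot t)
  repeated-isTransversal = record
    { ⊆U        = λ i → let (p , j) = remQuot t i in invariant-⊛ inv (+ toℕ j) (e p) (⊆U p)
    ; covers    = λ s u → let (pj , o) = repeated-covers s u in
                    uncurry combine pj , subst (InOrbit _ s ∘ repeated) (sym (Fin.remQuot-combine _ _)) o
    ; separates = λ i i′ o → remQuot-injective (repeated-separates _ _ o)
    }
    where
    remQuot-injective : ∀ {i i′} → remQuot {N} t i ≡ remQuot t i′ → i ≡ i′
    remQuot-injective {i} {i′} eq = trans (sym (Fin.combine-remQuot {N} t i))
      (trans (cong (uncurry combine) eq) (Fin.combine-remQuot {N} t i′))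

-- Sorting

module Sorting {a ℓ} {A : Set a} {_≤_ : Rel A ℓ} (isTotalOrder : IsTotalOrder _≡_ _≤_) where

  private
    totalOrder : TotalOrder a a ℓ
    totalOrder = record { isTotalOrder = isTotalOrder }

  open IsTotalOrder isTotalOrder using (total)
  open import Algebra.Construct.NaturalChoice.Min totalOrder using (_⊓_; minOperator; x≤y⇒x⊓y≈x; x≤y⇒y⊓x≈x)
  open import Algebra.Construct.NaturalChoice.Max totalOrder using (_⊔_; maxOperator; x≤y⇒x⊔y≈y; x≤y⇒y⊔x≈y)
  open import Algebra.Construct.NaturalChoice.MinMaxOp minOperator maxOperator
    using (⊓-comm; ⊔-comm; ⊓-sel; ⊔-sel; ⊓-mono-≤; ⊔-mono-≤; x⊓y≤x; x⊓y≤y; x≤x⊔y; x≤y⊔x; x⊓y≤x⊔y;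
           ⊔-distribˡ-⊓; ⊔-assoc; ⊓-commutativeSemigroup; ⊔-commutativeSemigroup)
  private
    module ⊓ = CommutativeSemigroup ⊓-commutativeSemigroup
    module ⊔ = CommutativeSemigroup ⊔-commutativeSemigroup

  -- Written with ⊓ and ⊔ rather than a comparison, so that monotonicity and independence of
  -- the order of the input become lattice identities.

  insert : ∀ {k} → A → Vec A k → Vec A (suc k)
  insert x []       = x ∷ []
  insert x (y ∷ ys) = x ⊓ y ∷ insert (x ⊔ y) ys

  sort : ∀ {k} → Vec A k → Vec A k
  sort []       = []
  sort (x ∷ xs) = insert x (sort xs)

  ⊓-⊔-cases : ∀ x y → (x ⊓ y ≡ x × x ⊔ y ≡ y) ⊎ (x ⊓ y ≡ y × x ⊔ y ≡ x)
  ⊓-⊔-cases x y = ⊎.map (λ x≤y → x≤y⇒x⊓y≈x x≤y , x≤y⇒x⊔y≈y x≤y)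
                         (λ y≤x → x≤y⇒y⊓x≈x y≤x , x≤y⇒y⊔x≈y y≤x) (total x y)

  median-comm : ∀ x y z → (x ⊔ (y ⊓ z)) ⊓ (y ⊔ z) ≡ (y ⊔ (x ⊓ z)) ⊓ (x ⊔ z)
  median-comm x y z = begin
    (x ⊔ (y ⊓ z)) ⊓ (y ⊔ z)          ≡⟨ cong (_⊓ (y ⊔ z)) (⊔-distribˡ-⊓ x y z) ⟩
    ((x ⊔ y) ⊓ (x ⊔ z)) ⊓ (y ⊔ z)    ≡⟨ ⊓.xy∙z≈xz∙y (x ⊔ y) (x ⊔ z) (y ⊔ z) ⟩
    ((x ⊔ y) ⊓ (y ⊔ z)) ⊓ (x ⊔ z)    ≡⟨ cong (λ u → (u ⊓ (y ⊔ z)) ⊓ (x ⊔ z)) (⊔-comm x y) ⟩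
    ((y ⊔ x) ⊓ (y ⊔ z)) ⊓ (x ⊔ z)    ≡⟨ cong (_⊓ (x ⊔ z)) (⊔-distribˡ-⊓ y x z) ⟨
    (y ⊔ (x ⊓ z)) ⊓ (x ⊔ z)          ∎
    where open ≡-Reasoning

  maximum-comm : ∀ x y z → (x ⊔ (y ⊓ z)) ⊔ (y ⊔ z) ≡ (y ⊔ (x ⊓ z)) ⊔ (x ⊔ z)
  maximum-comm x y z = begin
    (x ⊔ (y ⊓ z)) ⊔ (y ⊔ z)          ≡⟨ absorb x y z ⟩
    x ⊔ (y ⊔ z)                      ≡⟨ ⊔.x∙yz≈y∙xz x y z ⟩
    y ⊔ (x ⊔ z)                      ≡⟨ absorb y x z ⟨
    (y ⊔ (x ⊓ z)) ⊔ (x ⊔ z)          ∎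
    where
    open ≡-Reasoning
    absorb : ∀ x y z → (x ⊔ (y ⊓ z)) ⊔ (y ⊔ z) ≡ x ⊔ (y ⊔ z)
    absorb x y z = trans (⊔-assoc x (y ⊓ z) (y ⊔ z)) (cong (x ⊔_) (x≤y⇒x⊔y≈y (x⊓y≤x⊔y y z)))

  insert-⊓-⊔ : ∀ {k} {zs : Vec A k} → (∀ x y → insert x (insert y zs) ≡ insert y (insert x zs)) →
               ∀ x y → insert x (insert y zs) ≡ insert (x ⊓ y) (insert (x ⊔ y) zs)
  insert-⊓-⊔ swap x y with ⊓-⊔-cases x y
  ... | inj₁ (x⊓y≡x , x⊔y≡y) rewrite x⊓y≡x | x⊔y≡y = refl
  ... | inj₂ (x⊓y≡y , x⊔y≡x) rewrite x⊓y≡y | x⊔y≡x = swap x y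

  insert-comm : ∀ {k} x y (zs : Vec A k) → insert x (insert y zs) ≡ insert y (insert x zs)
  insert-comm x y []       = cong₂ (λ u v → u ∷ v ∷ []) (⊓-comm x y) (⊔-comm x y)
  insert-comm x y (z ∷ zs) = cong₂ _∷_ (⊓.x∙yz≈y∙xz x y z) (begin
    insert (x ⊔ (y ⊓ z)) (insert (y ⊔ z) zs)
      ≡⟨ insert-⊓-⊔ swap _ _ ⟩
    insert ((x ⊔ (y ⊓ z)) ⊓ (y ⊔ z)) (insert ((x ⊔ (y ⊓ z)) ⊔ (y ⊔ z)) zs)
      ≡⟨ cong₂ (λ u v → insert u (insert v zs)) (median-comm x y z) (maximum-comm x y z) ⟩
    insert ((y ⊔ (x ⊓ z)) ⊓ (x ⊔ z)) (insert ((y ⊔ (x ⊓ z)) ⊔ (x ⊔ z)) zs)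
      ≡⟨ insert-⊓-⊔ swap _ _ ⟨
    insert (y ⊔ (x ⊓ z)) (insert (x ⊔ z) zs) ∎)
    where
    open ≡-Reasoning
    swap : ∀ u v → insert u (insert v zs) ≡ insert v (insert u zs)
    swap u v = insert-comm u v zs

  sort-∷ʳ : ∀ {k} x (xs : Vec A k) → sort (xs ∷ʳ x) ≡ sort (x ∷ xs)
  sort-∷ʳ x []       = refl
  sort-∷ʳ x (y ∷ ys) = trans (cong (insert y) (sort-∷ʳ x ys)) (insert-comm y x (sort ys))

  module _ {r} {R : Rel A r}
           (R-⊓ : ∀ {x y u v} → R x y → R u v → R (x ⊓ u) (y ⊓ v))
           (R-⊔ : ∀ {x y u v} → R x y → R u v → R (x ⊔ u) (y ⊔ v)) where

    insert-pointwise : ∀ {k x y} {xs ys : Vec A k} → R x y → Pointwise R xs ys →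
                       Pointwise R (insert x xs) (insert y ys)
    insert-pointwise x~y []            = x~y ∷ []
    insert-pointwise x~y (x′~y′ ∷ rs) = R-⊓ x~y x′~y′ ∷ insert-pointwise (R-⊔ x~y x′~y′) rs

    sort-pointwise : ∀ {k} {xs ys : Vec A k} → Pointwise R xs ys → Pointwise R (sort xs) (sort ys)
    sort-pointwise []         = []
    sort-pointwise (x~y ∷ rs) = insert-pointwise x~y (sort-pointwise rs)

  sort-pointwise-≤ : ∀ {k} {xs ys : Vec A k} → Pointwise _≤_ xs ys → Pointwise _≤_ (sort xs) (sort ys)
  sort-pointwise-≤ = sort-pointwise ⊓-mono-≤ ⊔-mono-≤

  module _ {r} {_<_ : Rel A r} (≤-<-trans : Trans _≤_ _<_ _<_) (<-≤-trans : Trans _<_ _≤_ _<_) where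

    ⊓-mono-< : ∀ {x y u v} → x < y → u < v → (x ⊓ u) < (y ⊓ v)
    ⊓-mono-< {x} {y} {u} {v} x<y u<v with ⊓-sel y v
    ... | inj₁ y⊓v≡y rewrite y⊓v≡y = ≤-<-trans (x⊓y≤x x u) x<y
    ... | inj₂ y⊓v≡v rewrite y⊓v≡v = ≤-<-trans (x⊓y≤y x u) u<v

    ⊔-mono-< : ∀ {x y u v} → x < y → u < v → (x ⊔ u) < (y ⊔ v)
    ⊔-mono-< {x} {y} {u} {v} x<y u<v with ⊔-sel x u
    ... | inj₁ x⊔u≡x rewrite x⊔u≡x = <-≤-trans x<y (x≤x⊔y y v)
    ... | inj₂ x⊔u≡u rewrite x⊔u≡u = <-≤-trans u<v (x≤y⊔x y v)

    sort-pointwise-< : ∀ {k} {xs ys : Vec A k} → Pointwise _<_ xs ys → Pointwise _<_ (sort xs) (sort ys)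
    sort-pointwise-< = sort-pointwise ⊓-mono-< ⊔-mono-<

  module _ {c ℓ′} (M : CommutativeMonoid c ℓ′) (X : A → CommutativeMonoid.Carrier M) where
    open CommutativeMonoid M
      using (_≈_; _∙_; setoid; assoc; comm; ∙-congˡ; ∙-congʳ)
      renaming (refl to ≈-refl; trans to ≈-trans)
    open Sum M using (sum)
    open import Relation.Binary.Reasoning.Setoid setoid

    ∙-⊓-⊔ : ∀ x y → X (x ⊓ y) ∙ X (x ⊔ y) ≈ X x ∙ X y
    ∙-⊓-⊔ x y with ⊓-⊔-cases x y
    ... | inj₁ (x⊓y≡x , x⊔y≡y) rewrite x⊓y≡x | x⊔y≡y = ≈-refl
    ... | inj₂ (x⊓y≡y , x⊔y≡x) rewrite x⊓y≡y | x⊔y≡x = comm (X y) (X x)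

    sum-insert : ∀ {k} x (ys : Vec A k) →
                 sum (X ∘ Vec.lookup (insert x ys)) ≈ X x ∙ sum (X ∘ Vec.lookup ys)
    sum-insert x []       = ≈-refl
    sum-insert x (y ∷ ys) = begin
      X (x ⊓ y) ∙ sum (X ∘ Vec.lookup (insert (x ⊔ y) ys))  ≈⟨ ∙-congˡ (sum-insert (x ⊔ y) ys) ⟩
      X (x ⊓ y) ∙ (X (x ⊔ y) ∙ S)                           ≈⟨ assoc _ _ _ ⟨
      (X (x ⊓ y) ∙ X (x ⊔ y)) ∙ S                           ≈⟨ ∙-congʳ (∙-⊓-⊔ x y) ⟩
      (X x ∙ X y) ∙ S                                       ≈⟨ assoc _ _ _ ⟩
      X x ∙ (X y ∙ S)                                       ∎
      where S = sum (X ∘ Vec.lookup ys)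

    sum-sort : ∀ {k} (xs : Vec A k) → sum (X ∘ Vec.lookup (sort xs)) ≈ sum (X ∘ Vec.lookup xs)
    sum-sort []       = ≈-refl
    sum-sort (x ∷ xs) = ≈-trans (sum-insert x (sort xs)) (∙-congˡ (sum-sort xs))

-- Sorting the values of a tableau along the orbits of a translation

module _ {a} {A : Set a} (f : Cell → A) (w : Cell) where

  orbit : (k : ℕ) → Cell → Vec A k
  orbit zero    s = []
  orbit (suc k) s = f s ∷ orbit k (s ⊕ w)

  lookup-orbit : ∀ k s j → Vec.lookup (orbit k s) j ≡ f (s ⊕ ((+ toℕ j) ⊛ w))
  lookup-orbit (suc k) s Fin.zero    = cong f (sym (⊕-0⊛ s w))
  lookup-orbit (suc k) s (Fin.suc j) =
    trans (lookup-orbit k (s ⊕ w) j) (cong f (sym (⊕-suc⊛ s w (+ toℕ j))))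

  orbit-∷ʳ : ∀ k s → orbit (suc k) s ≡ orbit k s ∷ʳ f (s ⊕ ((+ k) ⊛ w))
  orbit-∷ʳ zero    s = cong (λ c → f c ∷ []) (sym (⊕-0⊛ s w))
  orbit-∷ʳ (suc k) s = cong (f s ∷_) (trans (orbit-∷ʳ k (s ⊕ w))
                                            (cong (λ c → orbit k (s ⊕ w) ∷ʳ f c) (sym (⊕-suc⊛ s w (+ k)))))

  orbit-pointwise : ∀ {U : Cell → Set} → Invariant U w →
                    ∀ {r} {R : Rel A r} (φ : Cell → Cell) → (∀ s d → φ (s ⊕ d) ≡ φ s ⊕ d) →
                    (∀ s → U s → U (φ s) → R (f s) (f (φ s))) →
                    ∀ k s → U s → U (φ s) → Pointwise R (orbit k s) (orbit k (φ s))
  orbit-pointwise inv φ φ-⊕ adjacent zero    s u uφ = []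
  orbit-pointwise {U} inv {R = R} φ φ-⊕ adjacent (suc k) s u uφ =
    adjacent s u uφ ∷ subst (Pointwise R (orbit k (s ⊕ w)) ∘ orbit k) (φ-⊕ s w)
      (orbit-pointwise inv φ φ-⊕ adjacent k (s ⊕ w) (proj₁ (inv s) u)
                       (subst U (sym (φ-⊕ s w)) (proj₁ (inv (φ s)) uφ)))

module SortedTableaux {m : ℕ} {U : Cell → Set} {w : Cell} (inv : Invariant U w)
                      (t₀ : ℕ) {F : Cell → Fin m} (F-csst : IsCSST m U ((+ suc t₀) ⊛ w) F) where
  open Sorting (Fin.≤-isTotalOrder {m})
  open IsCSST F-csst

  sortedOrbit : Cell → Vec (Fin m) (suc t₀)
  sortedOrbit s = sort (orbit F w (suc t₀) s)

  sortedTableau : Fin (suc t₀) → Cell → Fin m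
  sortedTableau k s = Vec.lookup (sortedOrbit s) k

  sortedOrbit-periodic : ∀ s → U s → sortedOrbit (s ⊕ w) ≡ sortedOrbit s
  sortedOrbit-periodic s u = begin
    sort (orbit F w (suc t₀) (s ⊕ w))
      ≡⟨ cong sort (orbit-∷ʳ F w t₀ (s ⊕ w)) ⟩
    sort (orbit F w t₀ (s ⊕ w) ∷ʳ F ((s ⊕ w) ⊕ ((+ t₀) ⊛ w)))
      ≡⟨ cong (λ c → sort (orbit F w t₀ (s ⊕ w) ∷ʳ F c)) (⊕-suc⊛ s w (+ t₀)) ⟨
    sort (orbit F w t₀ (s ⊕ w) ∷ʳ F (s ⊕ ((+ suc t₀) ⊛ w)))
      ≡⟨ cong (λ y → sort (orbit F w t₀ (s ⊕ w) ∷ʳ y)) (periodic s u) ⟩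
    sort (orbit F w t₀ (s ⊕ w) ∷ʳ F s)
      ≡⟨ sort-∷ʳ (F s) (orbit F w t₀ (s ⊕ w)) ⟩
    sort (orbit F w (suc t₀) s) ∎
    where open ≡-Reasoning

  sortedTableau-isCSST : ∀ k → IsCSST m U w (sortedTableau k)
  sortedTableau-isCSST k = record
    { periodic = λ s u → cong (λ xs → Vec.lookup xs k) (sortedOrbit-periodic s u)
    ; rows     = λ s u ur → Pointwise.lookup (sort-pointwise-≤
                   (orbit-pointwise F w inv right right-⊕ rows (suc t₀) s u ur)) k
    ; columns  = λ s u ud → Pointwise.lookup (sort-pointwise-< ℕ.≤-<-trans ℕ.<-≤-trans
                   (orbit-pointwise F w inv down down-⊕ columns (suc t₀) s u ud)) k
    }

  module _ {c ℓ} (M : CommutativeMonoid c ℓ) (X : Fin m → CommutativeMonoid.Carrier M) where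
    open CommutativeMonoid M using (_≈_) renaming (trans to ≈-trans; reflexive to ≈-reflexive)
    open Sum M using (sum; sum-cong-≗)

    sum-sortedTableau : ∀ s → sum {suc t₀} (λ k → X (sortedTableau k s)) ≈
                              sum {suc t₀} (λ j → X (F (s ⊕ ((+ toℕ j) ⊛ w))))
    sum-sortedTableau s = ≈-trans (sum-sort M X (orbit F w (suc t₀) s))
                                  (≈-reflexive (sum-cong-≗ (cong X ∘ lookup-orbit F w (suc t₀) s)))

module _ {c ℓ} (M : CommutativeMonoid c ℓ) where
  open CommutativeMonoid M
    using (Carrier; _≈_; _∙_; setoid; assoc; identityˡ; ∙-congˡ)
    renaming (refl to ≈-refl; sym to ≈-sym; trans to ≈-trans)
  open Sum M using (sum)
  open import Relation.Binary.Reasoning.Setoid setoid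

  sum-split : ∀ a b (g : Fin (a ℕ.+ b) → Carrier) →
              sum g ≈ sum {a} (λ i → g (i ↑ˡ b)) ∙ sum {b} (λ j → g (a ↑ʳ j))
  sum-split zero    b g = ≈-sym (identityˡ _)
  sum-split (suc a) b g = begin
    g Fin.zero ∙ sum (g ∘ Fin.suc)
      ≈⟨ ∙-congˡ (sum-split a b (g ∘ Fin.suc)) ⟩
    g Fin.zero ∙ (sum {a} (λ i → g (Fin.suc (i ↑ˡ b))) ∙ sum (λ j → g (Fin.suc (a ↑ʳ j))))
      ≈⟨ assoc _ _ _ ⟨
    (g Fin.zero ∙ sum {a} (λ i → g (Fin.suc (i ↑ˡ b)))) ∙ sum (λ j → g (Fin.suc (a ↑ʳ j))) ∎

  sum-combine : ∀ a b (g : Fin (a ℕ.* b) → Carrier) →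
                sum g ≈ sum {a} (λ p → sum {b} (λ j → g (combine p j)))
  sum-combine zero    b g = ≈-refl
  sum-combine (suc a) b g =
    ≈-trans (sum-split b (a ℕ.* b) g) (∙-congˡ (sum-combine a b (λ i → g (b ↑ʳ i))))

module _ {c ℓ₁ ℓ₂} {C : Set c} {_≈_ : Rel C ℓ₁} {_≲_ : Rel C ℓ₂}
         (isTotalPreorder : IsTotalPreorder _≈_ _≲_) where
  open IsTotalPreorder isTotalPreorder using (total) renaming (refl to ≲-refl; trans to ≲-trans)

  argmin : ∀ {k p} {P : Pred (Fin k) p} → Decidable P → (W : Fin k → C) →
           (∀ i → ¬ P i) ⊎ Σ (Fin k) λ i → P i × (∀ j → P j → W i ≲ W j)
  argmin {zero}  P? W = inj₁ λ ()
  argmin {suc k} P? W with argmin (P? ∘ Fin.suc) (W ∘ Fin.suc) | P? Fin.zero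
  ... | inj₁ none | no ¬p₀ = inj₁ λ { Fin.zero → ¬p₀ ; (Fin.suc i) → none i }
  ... | inj₁ none | yes p₀ =
    inj₂ (Fin.zero , p₀ , λ { Fin.zero _ → ≲-refl ; (Fin.suc j) pj → ⊥-elim (none j pj) })
  ... | inj₂ (i , pᵢ , min) | no ¬p₀ =
    inj₂ (Fin.suc i , pᵢ , λ { Fin.zero p₀ → ⊥-elim (¬p₀ p₀) ; (Fin.suc j) → min j })
  ... | inj₂ (i , pᵢ , min) | yes p₀ with total (W Fin.zero) (W (Fin.suc i))
  ...   | inj₁ W₀≲Wᵢ =
    inj₂ (Fin.zero , p₀ , λ { Fin.zero _ → ≲-refl ; (Fin.suc j) pj → ≲-trans W₀≲Wᵢ (min j pj) })
  ...   | inj₂ Wᵢ≲W₀ =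
    inj₂ (Fin.suc i , pᵢ , λ { Fin.zero _ → Wᵢ≲W₀ ; (Fin.suc j) → min j })

module _ {c ℓ₁ ℓ₂} (G : LinOrdAbGroup c ℓ₁ ℓ₂) where
  open LinOrdAbGroup G
    using (Carrier; _≤_; _∙_; Σ-list; _·_; isTotalOrder; ∙-monoˡ-≤; comm; commutativeMonoid)
  open IsTotalOrder isTotalOrder using (≤-respˡ-≈; ≤-respʳ-≈) renaming (trans to ≤-trans; refl to ≤-refl)
  open Sum commutativeMonoid using (sum)

  Σ-list-map : ∀ (g : Cell → Carrier) xs → Σ-list (map g xs) ≡ sum (g ∘ List.lookup xs)
  Σ-list-map g List.[]       = refl
  Σ-list-map g (s List.∷ xs) = cong (g s ∙_) (Σ-list-map g xs)

  ∙-mono-≤ : ∀ {x y u v} → x ≤ y → u ≤ v → (x ∙ u) ≤ (y ∙ v)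
  ∙-mono-≤ {x} {y} {u} {v} x≤y u≤v =
    ≤-trans (∙-monoˡ-≤ u x≤y) (≤-respˡ-≈ (comm u y) (≤-respʳ-≈ (comm v y) (∙-monoˡ-≤ y u≤v)))

  ·-≤-sum : ∀ t {y} {z : Fin t → Carrier} → (∀ k → y ≤ z k) → (t · y) ≤ sum z
  ·-≤-sum zero    y≤z = ≤-refl
  ·-≤-sum (suc t) y≤z = ∙-mono-≤ (y≤z Fin.zero) (·-≤-sum t (y≤z ∘ Fin.suc))

-- Cylindric tableaux of shape U / ℤv

module _ {c ℓ₁ ℓ₂} (G : LinOrdAbGroup c ℓ₁ ℓ₂) (n m a : ℕ) .{{_ : NonZero n}} .{{_ : NonZero a}}
         (x : Fin m → Fin n → LinOrdAbGroup.Carrier G)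
         {U : Cell → Set} (inv : Invariant U (vec n a))
         (D : List Cell) (D-fd : IsFundamentalDomain U (vec n a) D) where
  open LinOrdAbGroup G using (Carrier; _≈_; _≤_; _·_; isTotalOrder; commutativeMonoid; setoid)
  open IsTotalOrder isTotalOrder using (isTotalPreorder; ≤-respʳ-≈)
  open Sum commutativeMonoid using (sum; sum-cong-≗; sum-cong-≋; ∑-comm)

  private
    v : Cell
    v = vec n a

    e : Fin (length D) → Cell
    e = List.lookup D

    τ : IsTransversal U v e
    τ = fundamentalDomain⇒transversal D D-fd

    weight : List Cell → (Cell → Fin m) → Carrier
    weight = wt G n m x

  open IsTransversal τ

  module _ (t₀ : ℕ) (D′ : List Cell) (D′-fd : IsFundamentalDomain U ((+ suc t₀) ⊛ v) D′)
           {F′ : Cell → Fin m} (F′-csst : IsCSST m U ((+ suc t₀) ⊛ v) F′) where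
    open SortedTableaux inv t₀ F′-csst
    open import Relation.Binary.Reasoning.Setoid setoid

    private
      t : ℕ
      t = suc t₀

      h : Cell → Carrier
      h s = x (F′ s) (colour n s)

      h-periodic : ∀ s → U s → h (s ⊕ ((+ t) ⊛ v)) ≡ h s
      h-periodic s u = cong₂ x (IsCSST.periodic F′-csst s u) (colour-⊕-⊛ n a s (+ t))

    sum-weight-sortedTableau : sum {t} (λ k → weight D (sortedTableau k)) ≈ weight D′ F′
    sum-weight-sortedTableau = begin
      sum {t} (λ k → weight D (sortedTableau k))
        ≡⟨ sum-cong-≗ (λ k → Σ-list-map G (λ s → x (sortedTableau k s) (colour n s)) D) ⟩
      sum {t} (λ k → sum {N} (λ p → x (sortedTableau k (e p)) (colour n (e p))))
        ≈⟨ ∑-comm (λ k p → x (sortedTableau k (e p)) (colour n (e p))) ⟩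
      sum {N} (λ p → sum {t} (λ k → x (sortedTableau k (e p)) (colour n (e p))))
        ≈⟨ sum-cong-≋ (λ p → sum-sortedTableau commutativeMonoid (λ y → x y (colour n (e p))) (e p)) ⟩
      sum {N} (λ p → sum {t} (λ j → x (F′ (e p ⊕ ((+ toℕ j) ⊛ v))) (colour n (e p))))
        ≡⟨ sum-cong-≗ (λ p → sum-cong-≗ {t} λ j →
             cong (x (F′ (cells (p , j)))) (colour-⊕-⊛ n a (e p) (+ toℕ j))) ⟨
      sum {N} (λ p → sum {t} (λ j → h (cells (p , j))))
        ≡⟨ sum-cong-≗ (λ p → sum-cong-≗ λ j → cong (h ∘ cells) (Fin.remQuot-combine p j)) ⟨
      sum {N} (λ p → sum {t} (λ j → h (cells (remQuot t (combine p j)))))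
        ≈⟨ sum-combine commutativeMonoid N t (h ∘ cells ∘ remQuot t) ⟨
      sum (h ∘ cells ∘ remQuot t)
        ≈⟨ transversal-sum (invariant-multiple inv (+ t)) commutativeMonoid h h-periodic
             (repeated-isTransversal n a inv τ t) (fundamentalDomain⇒transversal D′ D′-fd) ⟩
      sum (h ∘ List.lookup D′)
        ≡⟨ Σ-list-map G h D′ ⟨
      weight D′ F′ ∎
      where
      N : ℕ
      N = length D
      cells : Fin N × Fin t → Cell
      cells = repeated n a inv τ t

    t·minimum≤weight : ∀ {T} → (∀ T″ → IsCSST m U v T″ → weight D T ≤ weight D T″) →
                       (t · weight D T) ≤ weight D′ F′
    t·minimum≤weight T-minimal = ≤-respʳ-≈ sum-weight-sortedTableau
      (·-≤-sum G t λ k → T-minimal (sortedTableau k) (sortedTableau-isCSST k))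

  module _ (default : Fin m) where

    -- Cells lying in no orbit of D lie outside U, so the default value there is irrelevant.
    extend : (Fin (length D) → Fin m) → Cell → Fin m
    extend f s with any? (λ p → inOrbit? n a s (e p))
    ... | yes (p , _) = f p
    ... | no _        = default

    extend-inOrbit : ∀ f {s} p → InOrbit v s (e p) → extend f s ≡ f p
    extend-inOrbit f {s} p o with any? (λ p → inOrbit? n a s (e p))
    ... | yes (p′ , o′) = cong f (separates p′ p (inOrbit-trans (inOrbit-sym o′) o))
    ... | no none       = ⊥-elim (none (p , o))

    Adjacent : (Cell → Cell) → Rel (Fin m) 0ℓ → (Fin (length D) → Fin m) → Set
    Adjacent φ R f = ∀ p q → InOrbit v (φ (e p)) (e q) → R (f p) (f q)

    adjacent? : ∀ φ {R} → (∀ y z → Dec (R y z)) → ∀ f → Dec (Adjacent φ R f)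
    adjacent? φ R? f = all? λ p → all? λ q → inOrbit? n a (φ (e p)) (e q) →-dec R? (f p) (f q)

    -- The row and column conditions on pairs of cells of D up to translation by v: decidable,
    -- and equivalent to semistandardness of the extension.
    IsLocallySemistandard : (Fin (length D) → Fin m) → Set
    IsLocallySemistandard f = Adjacent right Fin._≤_ f × Adjacent down Fin._<_ f

    isLocallySemistandard? : ∀ f → Dec (IsLocallySemistandard f)
    isLocallySemistandard? f = adjacent? right Fin._≤?_ f ×-dec adjacent? down Fin._<?_ f

    extend-adjacent : ∀ {φ R f} → (∀ s d → φ (s ⊕ d) ≡ φ s ⊕ d) → Adjacent φ R f →
                      ∀ s → U s → U (φ s) → R (extend f s) (extend f (φ s))
    extend-adjacent {φ} {R} {f} φ-⊕ adjacent s u uφ =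
      let (p , o) = covers s u ; (q , o′) = covers (φ s) uφ in
      subst₂ R (sym (extend-inOrbit f p o)) (sym (extend-inOrbit f q o′))
        (adjacent p q (inOrbit-trans (inOrbit-map φ φ-⊕ (inOrbit-sym o)) o′))

    extend-isCSST : ∀ {f} → IsLocallySemistandard f → IsCSST m U v (extend f)
    extend-isCSST {f} (rows , columns) = record
      { periodic = λ s u → let (p , o) = covers s u in
                     trans (extend-inOrbit f p (inOrbit-trans (inOrbit-step s) o))
                           (sym (extend-inOrbit f p o))
      ; rows     = extend-adjacent {R = Fin._≤_} {f} right-⊕ rows
      ; columns  = extend-adjacent {R = Fin._<_} {f} down-⊕ columns
      }

    restrict-adjacent : ∀ {T φ R f} → IsCSST m U v T → (∀ s → U s → U (φ s) → R (T s) (T (φ s))) →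
                        f ≗ T ∘ e → Adjacent φ R f
    restrict-adjacent {T} {φ} {R} T-csst adjacent f≗T∘e p q o =
      subst₂ R (sym (f≗T∘e p))
        (trans (periodic-inOrbit inv T (IsCSST.periodic T-csst) o (⊆U q)) (sym (f≗T∘e q)))
        (adjacent (e p) (⊆U p) (invariant-inOrbit inv o (⊆U q)))

    restrict-isLocallySemistandard : ∀ {T f} → IsCSST m U v T → f ≗ T ∘ e → IsLocallySemistandard f
    restrict-isLocallySemistandard T-csst f≗T∘e =
      restrict-adjacent {R = Fin._≤_} T-csst (IsCSST.rows T-csst) f≗T∘e ,
      restrict-adjacent {R = Fin._<_} T-csst (IsCSST.columns T-csst) f≗T∘e

    weight-extend : ∀ {T f} → f ≗ T ∘ e → weight D (extend f) ≡ weight D T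
    weight-extend {T} {f} f≗T∘e = begin
      weight D (extend f)                               ≡⟨ Σ-list-map G _ D ⟩
      sum (λ p → x (extend f (e p)) (colour n (e p)))  ≡⟨ sum-cong-≗ (cong (λ y → x y _) ∘ same-value) ⟩
      sum (λ p → x (T (e p)) (colour n (e p)))         ≡⟨ Σ-list-map G _ D ⟨
      weight D T                                        ∎
      where
      open ≡-Reasoning
      same-value : ∀ p → extend f (e p) ≡ T (e p)
      same-value p = trans (extend-inOrbit f p (inOrbit-refl (e p))) (f≗T∘e p)

    minimalTableau : ∀ {T₀} → IsCSST m U v T₀ →
                     Σ (Cell → Fin m) λ T →
                       IsCSST m U v T × (∀ T″ → IsCSST m U v T″ → weight D T ≤ weight D T″)
    minimalTableau {T₀} T₀-csst
      with argmin isTotalPreorder (isLocallySemistandard? ∘ finToFun) (weight D ∘ extend ∘ finToFun)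
    ... | inj₁ none = ⊥-elim (none (funToFin (T₀ ∘ e))
                        (restrict-isLocallySemistandard T₀-csst (Fin.finToFun-funToFin (T₀ ∘ e))))
    ... | inj₂ (i , local , minimal) = extend (finToFun i) , extend-isCSST local , λ T″ T″-csst →
          subst (weight D (extend (finToFun i)) ≤_) (weight-extend (Fin.finToFun-funToFin (T″ ∘ e)))
            (minimal (funToFin (T″ ∘ e))
              (restrict-isLocallySemistandard T″-csst (Fin.finToFun-funToFin (T″ ∘ e))))

mainTheorem1 : ∀ {c ℓ₁ ℓ₂} (G : LinOrdAbGroup c ℓ₁ ℓ₂) →
    let open LinOrdAbGroup G in
    (n m a : ℕ) .{{_ : NonZero n}} → 1 ℕ.≤ m → 1 ℕ.≤ a → a ℕ.≤ n ∸ 1 →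
    (x : Fin m → Fin n → Carrier) →
    (U : Cell → Set) → Invariant U (vec n a) →
    (D : List Cell) → IsFundamentalDomain U (vec n a) D →
    (t : ℕ) → 1 ℕ.≤ t →
    (D′ : List Cell) → IsFundamentalDomain U ((+ t) ⊛ vec n a) D′ →
    (F′ : Cell → Fin m) → IsCSST m U ((+ t) ⊛ vec n a) F′ →
    Σ (Cell → Fin m) λ T →
      IsCSST m U (vec n a) T ×
      (∀ (T″ : Cell → Fin m) → IsCSST m U (vec n a) T″ →
        wt G n m x D T ≤ wt G n m x D T″) ×
      ((t · wt G n m x D T) ≤ wt G n m x D′ F′)
mainTheorem1 G n m a 1≤m 1≤a _ x U inv D D-fd (suc t₀) _ D′ D′-fd F′ F′-csst =
  let (T , T-csst , T-minimal) = minimalTableau G n m a x inv D D-fd (fromℕ< 1≤m)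
                                   (sortedTableau-isCSST Fin.zero)
  in T , T-csst , T-minimal , t·minimum≤weight G n m a x inv D D-fd t₀ D′ D′-fd F′-csst T-minimal
  where
  open SortedTableaux inv t₀ F′-csst using (sortedTableau-isCSST)

  instance
    a≢0 : NonZero a
    a≢0 = ℕ.>-nonZero 1≤a
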